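{- Let $M$ be a matroid on $n$ elements and assume that its basis generating polynomial $f_M$ can be represented by a $(+,\times,/)$-circuit of size $s$. Then the basis generating polynomial $f_{M^*}$ of the dual matroid $M^*$ can be represented by a $(+,\times,/)$-circuit of size $s+2n$.
   Context: For a matroid $N$ on $E$ with bases $\mathcal{B}$, $f_N(x)=\sum_{B\in\mathcal{B}}\prod_{e\in B}x_e$. The dual $M^*$ has ground set $E$ and bases $\{E\setminus B:B\in\mathcal{B}\}$. A $(+,\times,/)$-circuit is a directed acyclic graph of input gates (labeled by variables) and in-degree-$2$ gates computing sum, product or quotient, with no constants and a unique output gate; its size is the number of non-input gates. -}

module Defs where

open import Data.Nat using (ℕ; zero; suc; _+_)
open import Data.Nat.Properties using () renaming (_≟_ to _≟ℕ_)
open import Data.Integer using (ℤ; 0ℤ; 1ℤ) renaming (_+_ to _+ℤ_; _*_ to _*ℤ_)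
open import Data.Bool using (Bool; true; false; T; if_then_else_)
open import Data.Fin as F using (Fin)
open import Data.Fin.Subset using (Subset; _∈_; _∉_; ∁; _∪_; _∩_; ⁅_⁆)
open import Data.Vec using (Vec; []; _∷_; replicate; zipWith) renaming (map to vmap)
open import Data.Vec.Properties using (≡-dec)
open import Data.List using (List; []; _∷_; _++_; filter; concatMap) renaming (map to lmap)
open import Data.Product using (_×_; _,_; ∃; ∃-syntax; proj₁; proj₂)
open import Data.Sum using (_⊎_; inj₁; inj₂)
open import Relation.Nullary using (¬_; yes; no)
open import Relation.Nullary.Decidable using (does)
open import Relation.Binary.PropositionalEquality using (_≡_; _≢_)

record Matroid (n : ℕ) : Set where
  field
    isBasis  : Subset n → Bool
    basis-nonempty : ∃[ B ] T (isBasis B)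
    exchange : ∀ (B₁ B₂ : Subset n) → T (isBasis B₁) → T (isBasis B₂) →
               ∀ (x : Fin n) → x ∈ B₁ → x ∉ B₂ →
               ∃[ y ] (y ∈ B₂ × y ∉ B₁ × T (isBasis ((B₁ ∩ ∁ ⁅ x ⁆) ∪ ⁅ y ⁆)))

open Matroid public

Monomial : ℕ → Set
Monomial n = Vec ℕ n

Poly : ℕ → Set
Poly n = List (ℤ × Monomial n)

coeff : ∀ {n} → Poly n → Monomial n → ℤ
coeff []            m = 0ℤ
coeff ((c , m') ∷ p) m with ≡-dec _≟ℕ_ m' m
... | yes _ = c +ℤ coeff p m
... | no  _ = coeff p m

_≈P_ : ∀ {n} → Poly n → Poly n → Set
p ≈P q = ∀ m → coeff p m ≡ coeff q m

NonZeroP : ∀ {n} → Poly n → Set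
NonZeroP p = ∃[ m ] (coeff p m ≢ 0ℤ)

_+P_ : ∀ {n} → Poly n → Poly n → Poly n
p +P q = p ++ q

_*P_ : ∀ {n} → Poly n → Poly n → Poly n
p *P q = concatMap (λ { (c , m) → lmap (λ { (d , m') → (c *ℤ d , zipWith _+_ m m') }) q }) p

oneP : ∀ {n} → Poly n
oneP {n} = (1ℤ , replicate n 0) ∷ []

varP : ∀ {n} → Fin n → Poly n
varP i = (1ℤ , vmap (λ b → if b then 1 else 0) ⁅ i ⁆) ∷ []

allSubsets : ∀ n → List (Subset n)
allSubsets zero    = [] ∷ []
allSubsets (suc n) = lmap (true ∷_) (allSubsets n) ++ lmap (false ∷_) (allSubsets n)

monomialOf : ∀ {n} → Subset n → Monomial n
monomialOf B = vmap (λ b → if b then 1 else 0) B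

basisGenPoly : ∀ {n} → (Subset n → Bool) → Poly n
basisGenPoly {n} bases = lmap (λ B → (1ℤ , monomialOf B)) (filter (λ B → T? (bases B)) (allSubsets n))
  where
  open import Relation.Nullary.Decidable using (T?)

f : ∀ {n} → Matroid n → Poly n
f M = basisGenPoly (isBasis M)

dualBases : ∀ {n} → Matroid n → Subset n → Bool
dualBases M B = isBasis M (∁ B)

fDual : ∀ {n} → Matroid n → Poly n
fDual M = basisGenPoly (dualBases M)

-- (+,×,/)-circuits in variables x_0..x_{n-1}, without constants,
-- as straight-line programs (a topological order of the DAG).

data Op : Set where
  plus times div : Op

Node : ℕ → ℕ → Set
Node n k = Fin n ⊎ Fin k

data Gates (n : ℕ) : ℕ → Set where
  []  : Gates n 0
  _▷_ : ∀ {k} → Gates n k → Op × Node n k × Node n k → Gates n (suc k)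

-- A circuit of size s: s non-input gates and a designated output node.
record Circuit (n s : ℕ) : Set where
  constructor circuit
  field
    gates  : Gates n s
    output : Node n s

-- Semantics: each node computes a rational function num/den,
-- represented by a pair of polynomials (numerator , denominator).
Frac : ℕ → Set
Frac n = Poly n × Poly n

opFrac : ∀ {n} → Op → Frac n → Frac n → Frac n
opFrac plus  (a , b) (c , d) = ((a *P d) +P (c *P b)) , (b *P d)
opFrac times (a , b) (c , d) = (a *P c) , (b *P d)
opFrac div   (a , b) (c , d) = (a *P d) , (b *P c)

value : ∀ {n k} → Gates n k → Node n k → Frac n
value gs         (inj₁ i)          = varP i , oneP
value (gs ▷ (o , u , v)) (inj₂ F.zero)    = opFrac o (value gs u) (value gs v)
value (gs ▷ g)   (inj₂ (F.suc j)) = value gs (inj₂ j)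

data WellDefined {n : ℕ} : ∀ {k} → Gates n k → Set where
  []   : WellDefined []
  cons : ∀ {k} {gs : Gates n k} {o u v} → WellDefined gs →
         (o ≡ div → NonZeroP (proj₁ (value gs v))) →
         WellDefined (gs ▷ (o , u , v))

Represents : ∀ {n s} → Circuit n s → Poly n → Set
Represents (circuit gs out) p =
  WellDefined gs × (proj₁ (value gs out) ≈P (p *P proj₂ (value gs out)))

-- Since the complements of the bases of M are the bases of M*, over Laurent monomials
-- f_{M*}(x) = x₁⋯xₙ · f_M(1/x₁, …, 1/xₙ).  So a circuit for f_{M*} is obtained from one for f_M
-- by feeding it 1/xᵢ instead of each input xᵢ and multiplying its output by P = x₁⋯xₙ.
-- Without constants, 1/xᵢ is computed as Q/(xᵢQ) for a partial product Q: for n ≥ 2 the gates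
-- x₁x₂, x₂/(x₁x₂), x₁/(x₁x₂), and then Qxᵢ, Q/(Qxᵢ) for i ≥ 3, give all reciprocals and P in
-- 2n − 1 gates, and one more gate multiplies by P.  Circuits compute numerator and denominator
-- separately, so the substitution is tracked on both as the reflection x^a ↦ x^(e − a) with a
-- common e ∈ ℤⁿ, which cancels in the fraction.  For n ≤ 1, f_{M*} is x₁ or 1.

module Submission where

open import Algebra.Bundles using (AbelianGroup)
import Algebra.Properties.AbelianGroup as AbelianGroupProperties
import Algebra.Properties.CommutativeSemigroup as CommutativeSemigroupProperties
open import Data.Bool using (Bool; true; false; T; if_then_else_)
open import Data.Fin as Fin using (Fin; zero; suc)
open import Data.Fin.Subset using (Subset; ⁅_⁆; ⊥; ∁)
open import Data.Integer
  using (ℤ; +_; -[1+_]; 0ℤ; 1ℤ) renaming (_+_ to _+ℤ_; _*_ to _*ℤ_; -_ to -ℤ_; _≟_ to _≟ℤ_)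
import Data.Integer.Properties as ℤ
open import Data.List as List using (List; []; _∷_; _++_; concatMap; length)
open import Data.List.Membership.Propositional using (_∈_)
open import Data.List.Membership.Propositional.Properties using (∈-allFin)
import Data.List.Properties as List
open import Data.List.Relation.Binary.Permutation.Propositional as ↭ using (_↭_)
import Data.List.Relation.Binary.Permutation.Propositional.Properties as ↭
open import Data.List.Relation.Unary.Any using (here; there)
open import Data.Nat using (ℕ; zero; suc; _+_; _*_)
import Data.Nat.Properties as ℕ
open import Data.Nat.Tactic.RingSolver using (solve-∀)
open import Data.Product using (_×_; _,_; proj₁; proj₂; ∃-syntax)
open import Data.Sum using (_⊎_; inj₁; inj₂)
open import Data.Vec as Vec using (Vec; []; _∷_; zipWith; replicate)
import Data.Vec.Properties as Vec
open import Function using (_∘_; id)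
open import Level using (0ℓ)
open import Relation.Binary.Bundles using (Setoid)
import Relation.Binary.Construct.On as On
open import Relation.Binary.PropositionalEquality
open import Relation.Nullary using (¬_; Dec; yes; no; does; contradiction)
open import Relation.Nullary.Decidable using (dec-true; T?)

open import Defs

open CommutativeSemigroupProperties ℤ.+-commutativeSemigroup
  using () renaming (x∙yz≈y∙xz to ℤ-x∙yz≈y∙xz)

Exponent : ℕ → Set
Exponent n = Vec ℤ n

infixl 6 _⊕_ _⊖_

_⊕_ : ∀ {n} → Exponent n → Exponent n → Exponent n
_⊕_ = zipWith _+ℤ_

⊝_ : ∀ {n} → Exponent n → Exponent n
⊝_ = Vec.map -ℤ_

_⊖_ : ∀ {n} → Exponent n → Exponent n → Exponent n
a ⊖ b = a ⊕ ⊝ b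

𝟘 𝟙 : ∀ {n} → Exponent n
𝟘 = replicate _ 0ℤ
𝟙 = replicate _ 1ℤ

exponentGroup : ℕ → AbelianGroup 0ℓ 0ℓ
exponentGroup n = record
  { Carrier        = Exponent n
  ; _≈_            = _≡_
  ; _∙_            = _⊕_
  ; ε              = 𝟘
  ; _⁻¹            = ⊝_
  ; isAbelianGroup = record
    { isGroup = record
      { isMonoid = record
        { isSemigroup = record
          { isMagma = record { isEquivalence = isEquivalence ; ∙-cong = cong₂ _⊕_ }
          ; assoc   = Vec.zipWith-assoc ℤ.+-assoc
          }
        ; identity = Vec.zipWith-identityˡ ℤ.+-identityˡ , Vec.zipWith-identityʳ ℤ.+-identityʳ
        }
      ; inverse = Vec.zipWith-inverseˡ ℤ.+-inverseˡ , Vec.zipWith-inverseʳ ℤ.+-inverseʳ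
      ; ⁻¹-cong = cong ⊝_
      }
    ; comm = Vec.zipWith-comm ℤ.+-comm
    }
  }

module _ {n : ℕ} where

  open AbelianGroup (exponentGroup n) public
    using () renaming (assoc to ⊕-assoc; comm to ⊕-comm; identityˡ to ⊕-identityˡ; identityʳ to ⊕-identityʳ)
  open CommutativeSemigroupProperties (AbelianGroup.commutativeSemigroup (exponentGroup n)) public
    using (x∙yz≈y∙xz) renaming (interchange to ⊕-interchange)
  open AbelianGroupProperties (exponentGroup n)
  open ≡-Reasoning

  ⊖-involutive : (e a : Exponent n) → e ⊖ (e ⊖ a) ≡ a
  ⊖-involutive e a = begin
    e ⊕ ⊝ (e ⊖ a)  ≡⟨ cong (e ⊕_) (⁻¹-anti-homo-// e a) ⟩
    e ⊕ (a ⊖ e)    ≡⟨ ⊕-assoc e a (⊝ e) ⟨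
    e ⊕ a ⊖ e      ≡⟨ xyx⁻¹≈y e a ⟩
    a              ∎

  ⊖-⊕-distrib : (e₁ e₂ a b : Exponent n) → (e₁ ⊕ e₂) ⊖ (a ⊕ b) ≡ (e₁ ⊖ a) ⊕ (e₂ ⊖ b)
  ⊖-⊕-distrib e₁ e₂ a b = begin
    (e₁ ⊕ e₂) ⊕ ⊝ (a ⊕ b)    ≡⟨ cong ((e₁ ⊕ e₂) ⊕_) (⁻¹-∙-comm a b) ⟨
    (e₁ ⊕ e₂) ⊕ (⊝ a ⊕ ⊝ b)  ≡⟨ ⊕-interchange e₁ e₂ (⊝ a) (⊝ b) ⟩
    (e₁ ⊖ a) ⊕ (e₂ ⊖ b)      ∎

  ⊖-⊕-cancelʳ : (x y : Exponent n) → x ⊖ (y ⊕ x) ≡ ⊝ y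
  ⊖-⊕-cancelʳ x y = begin
    x ⊕ ⊝ (y ⊕ x)    ≡⟨ cong (x ⊕_) (⁻¹-anti-homo-∙ y x) ⟩
    x ⊕ (⊝ x ⊕ ⊝ y)  ≡⟨ \\-leftDividesˡ x (⊝ y) ⟩
    ⊝ y              ∎

  ⊖-⊕-cancel : (a b d d′ : Exponent n) → (a ⊖ b) ⊕ (d ⊕ (b ⊕ d′)) ≡ a ⊕ d ⊕ d′
  ⊖-⊕-cancel a b d d′ = begin
    (a ⊕ ⊝ b) ⊕ (d ⊕ (b ⊕ d′))  ≡⟨ cong ((a ⊕ ⊝ b) ⊕_) (x∙yz≈y∙xz d b d′) ⟩
    (a ⊕ ⊝ b) ⊕ (b ⊕ (d ⊕ d′))  ≡⟨ ⊕-assoc a (⊝ b) _ ⟩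
    a ⊕ (⊝ b ⊕ (b ⊕ (d ⊕ d′)))  ≡⟨ cong (a ⊕_) (\\-leftDividesʳ b (d ⊕ d′)) ⟩
    a ⊕ (d ⊕ d′)                ≡⟨ ⊕-assoc a d d′ ⟨
    a ⊕ d ⊕ d′                  ∎

  ⊖-𝟘 : (x : Exponent n) → x ⊖ 𝟘 ≡ x
  ⊖-𝟘 x = trans (cong (x ⊕_) ε⁻¹≈ε) (⊕-identityʳ x)

Terms : Set → Set
Terms A = List (ℤ × A)

mapTerms : ∀ {A B} → (A → B) → Terms A → Terms B
mapTerms φ = List.map (λ (c , a) → c , φ a)

termTimes : ∀ {A} → (A → A → A) → ℤ × A → Terms A → Terms A
termTimes _∙_ (c , a) = List.map (λ (d , b) → c *ℤ d , a ∙ b)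

mulTerms : ∀ {A} → (A → A → A) → Terms A → Terms A → Terms A
mulTerms _∙_ X Y = concatMap (λ t → termTimes _∙_ t Y) X

mapTerms-mulTerms : ∀ {A B} {_∙_ : A → A → A} {_∘_ : B → B → B} (φ φ₁ φ₂ : A → B) →
                    (∀ a b → φ (a ∙ b) ≡ φ₁ a ∘ φ₂ b) → ∀ X Y →
                    mapTerms φ (mulTerms _∙_ X Y) ≡ mulTerms _∘_ (mapTerms φ₁ X) (mapTerms φ₂ Y)
mapTerms-mulTerms φ φ₁ φ₂ hom []            Y = refl
mapTerms-mulTerms {_∙_ = _∙_} {_∘_} φ φ₁ φ₂ hom ((c , a) ∷ X) Y =
  trans (List.map-++ _ (termTimes _∙_ (c , a) Y) _) (cong₂ _++_ row (mapTerms-mulTerms φ φ₁ φ₂ hom X Y))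
  where
  row : mapTerms φ (termTimes _∙_ (c , a) Y) ≡ termTimes _∘_ (c , φ₁ a) (mapTerms φ₂ Y)
  row = trans (sym (List.map-∘ Y))
              (trans (List.map-cong (λ (d , b) → cong (c *ℤ d ,_) (hom a b)) Y) (List.map-∘ Y))

LPoly : ℕ → Set
LPoly n = Terms (Exponent n)

infixl 7 _*L_

_*L_ : ∀ {n} → LPoly n → LPoly n → LPoly n
_*L_ = mulTerms _⊕_

monomial : ∀ {n} → Exponent n → LPoly n
monomial a = (1ℤ , a) ∷ []

toExponent : ∀ {n} → Monomial n → Exponent n
toExponent = Vec.map (λ k → + k)

embed : ∀ {n} → Poly n → LPoly n
embed = mapTerms toExponent

-- reflect e X = x^e · X(1/x)
reflect : ∀ {n} → Exponent n → LPoly n → LPoly n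
reflect e = mapTerms (e ⊖_)

toExponent-+ : ∀ {n} (a b : Monomial n) → toExponent (zipWith _+_ a b) ≡ toExponent a ⊕ toExponent b
toExponent-+ []      []      = refl
toExponent-+ (x ∷ a) (y ∷ b) = cong₂ _∷_ (ℤ.pos-+ x y) (toExponent-+ a b)

*P-mulTerms : ∀ {n} (p q : Poly n) → p *P q ≡ mulTerms (zipWith _+_) p q
*P-mulTerms []            q = refl
*P-mulTerms ((c , m) ∷ p) q = cong₂ _++_ (List.map-cong (λ _ → refl) q) (*P-mulTerms p q)

embed-*P : ∀ {n} (p q : Poly n) → embed (p *P q) ≡ embed p *L embed q
embed-*P p q =
  trans (cong embed (*P-mulTerms p q)) (mapTerms-mulTerms toExponent toExponent toExponent toExponent-+ p q)

embed-+P : ∀ {n} (p q : Poly n) → embed (p +P q) ≡ embed p ++ embed q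
embed-+P p q = List.map-++ _ p q

reflect-*L : ∀ {n} (e₁ e₂ : Exponent n) (X Y : LPoly n) →
             reflect (e₁ ⊕ e₂) (X *L Y) ≡ reflect e₁ X *L reflect e₂ Y
reflect-*L e₁ e₂ = mapTerms-mulTerms _ _ _ (⊖-⊕-distrib e₁ e₂)

reflect-++ : ∀ {n} (e : Exponent n) (X Y : LPoly n) → reflect e (X ++ Y) ≡ reflect e X ++ reflect e Y
reflect-++ e X Y = List.map-++ _ X Y

monomial-*L-reflect : ∀ {n} (b e : Exponent n) X → monomial b *L reflect e X ≡ reflect (b ⊕ e) X
monomial-*L-reflect b e X =
  trans (List.++-identityʳ _)
        (trans (sym (List.map-∘ X))
               (List.map-cong (λ (c , a) → cong₂ _,_ (ℤ.*-identityˡ c) (sym (⊕-assoc b e (⊝ a)))) X))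

_≟ᵉ_ : ∀ {n} (a b : Exponent n) → Dec (a ≡ b)
_≟ᵉ_ = Vec.≡-dec _≟ℤ_

coeffTerm : ∀ {n} → ℤ × Exponent n → Exponent n → ℤ
coeffTerm (c , a) z = if does (a ≟ᵉ z) then c else 0ℤ

coeffL : ∀ {n} → LPoly n → Exponent n → ℤ
coeffL []      z = 0ℤ
coeffL (t ∷ X) z = coeffTerm t z +ℤ coeffL X z

infix 4 _≈L_

_≈L_ : ∀ {n} → LPoly n → LPoly n → Set
X ≈L Y = coeffL X ≗ coeffL Y

≈L-setoid : ℕ → Setoid 0ℓ 0ℓ
≈L-setoid n = On.setoid (Exponent n →-setoid ℤ) coeffL

coeffL-reflect : ∀ {n} (e : Exponent n) X z → coeffL (reflect e X) z ≡ coeffL X (e ⊖ z)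
coeffL-reflect e []            z = refl
coeffL-reflect e ((c , a) ∷ X) z with (e ⊖ a) ≟ᵉ z | a ≟ᵉ (e ⊖ z)
... | yes _       | yes _      = cong (c +ℤ_) (coeffL-reflect e X z)
... | no  _       | no  _      = cong (0ℤ +ℤ_) (coeffL-reflect e X z)
... | yes e-a≡z   | no  a≢e-z  = contradiction (trans (sym (⊖-involutive e a)) (cong (e ⊖_) e-a≡z)) a≢e-z
... | no  e-a≢z   | yes refl   = contradiction (⊖-involutive e z) e-a≢z

reflect-≈L : ∀ {n} (e : Exponent n) {X Y} → X ≈L Y → reflect e X ≈L reflect e Y
reflect-≈L e {X} {Y} X≈Y z =
  trans (coeffL-reflect e X z) (trans (X≈Y (e ⊖ z)) (sym (coeffL-reflect e Y z)))

coeffL-↭ : ∀ {n} {X Y : LPoly n} → X ↭ Y → X ≈L Y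
coeffL-↭ ↭.refl         z = refl
coeffL-↭ (↭.prep t p)   z = cong (coeffTerm t z +ℤ_) (coeffL-↭ p z)
coeffL-↭ (↭.swap t u p) z =
  trans (cong (λ r → coeffTerm t z +ℤ (coeffTerm u z +ℤ r)) (coeffL-↭ p z))
        (ℤ-x∙yz≈y∙xz (coeffTerm t z) (coeffTerm u z) _)
coeffL-↭ (↭.trans p q)  z = trans (coeffL-↭ p z) (coeffL-↭ q z)

*L-↭ˡ : ∀ {n} {X X′ : LPoly n} (Y : LPoly n) → X ↭ X′ → X *L Y ↭ X′ *L Y
*L-↭ˡ Y ↭.refl         = ↭.refl
*L-↭ˡ Y (↭.prep t p)   = ↭.++⁺ˡ (termTimes _⊕_ t Y) (*L-↭ˡ Y p)
*L-↭ˡ Y (↭.swap t u p) =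
  ↭.trans (↭.shifts (termTimes _⊕_ t Y) (termTimes _⊕_ u Y))
          (↭.++⁺ˡ (termTimes _⊕_ u Y) (↭.++⁺ˡ (termTimes _⊕_ t Y) (*L-↭ˡ Y p)))
*L-↭ˡ Y (↭.trans p q)  = ↭.trans (*L-↭ˡ Y p) (*L-↭ˡ Y q)

toExponent-injective : ∀ {n} {a b : Monomial n} → toExponent a ≡ toExponent b → a ≡ b
toExponent-injective {a = []}    {[]}    _  = refl
toExponent-injective {a = x ∷ a} {y ∷ b} eq =
  cong₂ _∷_ (ℤ.+-injective (Vec.∷-injectiveˡ eq)) (toExponent-injective (Vec.∷-injectiveʳ eq))

toExponent⁻¹? : ∀ {n} (z : Exponent n) → Dec (∃[ m ] toExponent m ≡ z)
toExponent⁻¹? []             = yes ([] , refl)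
toExponent⁻¹? (-[1+ _ ] ∷ _) = no λ { (_ ∷ _ , ()) }
toExponent⁻¹? (+ k ∷ z) with toExponent⁻¹? z
... | yes (m , refl) = yes (k ∷ m , refl)
... | no  z∉im       = no λ { (_ ∷ m , eq) → z∉im (m , Vec.∷-injectiveʳ eq) }

coeffL-embed : ∀ {n} (p : Poly n) m → coeffL (embed p) (toExponent m) ≡ coeff p m
coeffL-embed []             m = refl
coeffL-embed ((c , m′) ∷ p) m with toExponent m′ ≟ᵉ toExponent m | Vec.≡-dec ℕ._≟_ m′ m
... | yes _  | yes _    = cong (c +ℤ_) (coeffL-embed p m)
... | no  _  | no  _    = trans (ℤ.+-identityˡ _) (coeffL-embed p m)
... | yes eq | no  m′≢m = contradiction (toExponent-injective eq) m′≢m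
... | no neq | yes refl = contradiction refl neq

coeffL-embed-∉ : ∀ {n} (p : Poly n) {z} → ¬ (∃[ m ] toExponent m ≡ z) → coeffL (embed p) z ≡ 0ℤ
coeffL-embed-∉ []                 z∉im = refl
coeffL-embed-∉ ((c , m′) ∷ p) {z} z∉im with toExponent m′ ≟ᵉ z
... | yes eq = contradiction (m′ , eq) z∉im
... | no  _  = trans (ℤ.+-identityˡ _) (coeffL-embed-∉ p z∉im)

embed-≈ : ∀ {n} {p q : Poly n} → p ≈P q → embed p ≈L embed q
embed-≈ {p = p} {q} p≈q z with toExponent⁻¹? z
... | yes (m , refl) = trans (coeffL-embed p m) (trans (p≈q m) (sym (coeffL-embed q m)))
... | no  z∉im       = trans (coeffL-embed-∉ p z∉im) (sym (coeffL-embed-∉ q z∉im))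

≈L-embed : ∀ {n} {p q : Poly n} → embed p ≈L embed q → p ≈P q
≈L-embed {p = p} {q} p≈q m =
  trans (sym (coeffL-embed p m)) (trans (p≈q (toExponent m)) (coeffL-embed q m))

NonZeroP-embed : ∀ {n} (p : Poly n) {z} → coeffL (embed p) z ≢ 0ℤ → NonZeroP p
NonZeroP-embed p {z} nz with toExponent⁻¹? z
... | yes (m , refl) = m , λ c≡0 → nz (trans (coeffL-embed p m) c≡0)
... | no  z∉im       = contradiction (coeffL-embed-∉ p z∉im) nz

-- (A , B) = x^e · (N , D)(1/x) for a single e, so that A/B is N/D evaluated at 1/x.
Reflects : ∀ {n} → Frac n → Frac n → Set
Reflects (N , D) (A , B) = ∃[ e ] embed A ≡ reflect e (embed N) × embed B ≡ reflect e (embed D)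

reflected-*P : ∀ {n} {A₁ A₂ N₁ N₂ : Poly n} {e₁ e₂} →
               embed A₁ ≡ reflect e₁ (embed N₁) → embed A₂ ≡ reflect e₂ (embed N₂) →
               embed (A₁ *P A₂) ≡ reflect (e₁ ⊕ e₂) (embed (N₁ *P N₂))
reflected-*P {A₁ = A₁} {A₂} {N₁} {N₂} {e₁} {e₂} eq₁ eq₂ = begin
  embed (A₁ *P A₂)                                ≡⟨ embed-*P A₁ A₂ ⟩
  embed A₁ *L embed A₂                            ≡⟨ cong₂ _*L_ eq₁ eq₂ ⟩
  reflect e₁ (embed N₁) *L reflect e₂ (embed N₂)  ≡⟨ reflect-*L e₁ e₂ (embed N₁) (embed N₂) ⟨
  reflect (e₁ ⊕ e₂) (embed N₁ *L embed N₂)        ≡⟨ cong (reflect _) (embed-*P N₁ N₂) ⟨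
  reflect (e₁ ⊕ e₂) (embed (N₁ *P N₂))            ∎
  where open ≡-Reasoning

reflected-+P : ∀ {n} {A₁ A₂ N₁ N₂ : Poly n} {e} →
               embed A₁ ≡ reflect e (embed N₁) → embed A₂ ≡ reflect e (embed N₂) →
               embed (A₁ +P A₂) ≡ reflect e (embed (N₁ +P N₂))
reflected-+P {A₁ = A₁} {A₂} {N₁} {N₂} {e} eq₁ eq₂ = begin
  embed (A₁ +P A₂)                              ≡⟨ embed-+P A₁ A₂ ⟩
  embed A₁ ++ embed A₂                          ≡⟨ cong₂ _++_ eq₁ eq₂ ⟩
  reflect e (embed N₁) ++ reflect e (embed N₂)  ≡⟨ reflect-++ e (embed N₁) (embed N₂) ⟨
  reflect e (embed N₁ ++ embed N₂)              ≡⟨ cong (reflect e) (embed-+P N₁ N₂) ⟨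
  reflect e (embed (N₁ +P N₂))                  ∎
  where open ≡-Reasoning

Reflects-opFrac : ∀ {n} (o : Op) {u₁ u₂ v₁ v₂ : Frac n} → Reflects u₁ v₁ → Reflects u₂ v₂ →
                  Reflects (opFrac o u₁ u₂) (opFrac o v₁ v₂)
Reflects-opFrac plus  (e₁ , a₁ , b₁) (e₂ , a₂ , b₂) =
  e₁ ⊕ e₂ ,
  reflected-+P (reflected-*P a₁ b₂)
               (subst (λ e → _ ≡ reflect e _) (⊕-comm e₂ e₁) (reflected-*P a₂ b₁)) ,
  reflected-*P b₁ b₂
Reflects-opFrac times (e₁ , a₁ , b₁) (e₂ , a₂ , b₂) =
  e₁ ⊕ e₂ , reflected-*P a₁ a₂ , reflected-*P b₁ b₂
Reflects-opFrac div   (e₁ , a₁ , b₁) (e₂ , a₂ , b₂) =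
  e₁ ⊕ e₂ , reflected-*P a₁ b₂ , reflected-*P b₁ a₂

NonZeroP-reflected : ∀ {n} {A N : Poly n} {e} → embed A ≡ reflect e (embed N) → NonZeroP N → NonZeroP A
NonZeroP-reflected {A = A} {N} {e} A≡eN (m , nz) = NonZeroP-embed A λ c≡0 → nz (begin
  coeff N m                                        ≡⟨ coeffL-embed N m ⟨
  coeffL (embed N) (toExponent m)                  ≡⟨ cong (coeffL (embed N)) (⊖-involutive e _) ⟨
  coeffL (embed N) (e ⊖ (e ⊖ toExponent m))        ≡⟨ coeffL-reflect e (embed N) _ ⟨
  coeffL (reflect e (embed N)) (e ⊖ toExponent m)  ≡⟨ cong (λ X → coeffL X _) A≡eN ⟨
  coeffL (embed A) (e ⊖ toExponent m)              ≡⟨ c≡0 ⟩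
  0ℤ                                               ∎)
  where open ≡-Reasoning

module Graft {n p : ℕ} (pre : Gates n p) (ρ : Fin n → Node n p) where

  liftPre : ∀ k → Node n p → Node n (k + p)
  liftPre k (inj₁ i) = inj₁ i
  liftPre k (inj₂ j) = inj₂ (k Fin.↑ʳ j)

  rename : ∀ {k} → Node n k → Node n (k + p)
  rename {k} (inj₁ i) = liftPre k (ρ i)
  rename     (inj₂ j) = inj₂ (j Fin.↑ˡ p)

  graft : ∀ {k} → Gates n k → Gates n (k + p)
  graft []                 = pre
  graft (gs ▷ (o , u , v)) = graft gs ▷ (o , rename u , rename v)

  value-liftPre : ∀ {k} (gs : Gates n k) (u : Node n p) → value (graft gs) (liftPre k u) ≡ value pre u
  value-liftPre gs       (inj₁ i) = refl
  value-liftPre []       (inj₂ j) = refl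
  value-liftPre (gs ▷ _) (inj₂ j) = value-liftPre gs (inj₂ j)

  module _ (ρ-reflects : ∀ i → Reflects (varP i , oneP) (value pre (ρ i))) where

    Reflects-graft : ∀ {k} (gs : Gates n k) (u : Node n k) →
                     Reflects (value gs u) (value (graft gs) (rename u))
    Reflects-graft gs                 (inj₁ i)       =
      subst (Reflects (varP i , oneP)) (sym (value-liftPre gs (ρ i))) (ρ-reflects i)
    Reflects-graft (gs ▷ (o , u , v)) (inj₂ zero)    = Reflects-opFrac o (Reflects-graft gs u) (Reflects-graft gs v)
    Reflects-graft (gs ▷ _)           (inj₂ (suc j)) = Reflects-graft gs (inj₂ j)

    WellDefined-graft : WellDefined pre → ∀ {k} {gs : Gates n k} → WellDefined gs → WellDefined (graft gs)
    WellDefined-graft wd-pre []                                  = wd-pre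
    WellDefined-graft wd-pre {gs = gs ▷ (o , u , v)} (cons wd nz) =
      cons (WellDefined-graft wd-pre wd)
           (λ o≡div → let (_ , A≡eN , _) = Reflects-graft gs v in NonZeroP-reflected A≡eN (nz o≡div))

𝕖 : ∀ {n} → Fin n → Exponent n
𝕖 i = toExponent (monomialOf ⁅ i ⁆)

MonomialFrac : ∀ {n} → Frac n → Exponent n → Set
MonomialFrac (N , D) c = ∃[ d ] embed N ≡ monomial (c ⊕ d) × embed D ≡ monomial d

toExponent-𝟘 : ∀ {n} → toExponent (replicate n 0) ≡ 𝟘
toExponent-𝟘 {n} = Vec.map-replicate _ 0 n

MonomialFrac-var : ∀ {n} (i : Fin n) → MonomialFrac (varP i , oneP) (𝕖 i)
MonomialFrac-var i =
  toExponent (replicate _ 0) ,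
  cong monomial (sym (trans (cong (𝕖 i ⊕_) toExponent-𝟘) (⊕-identityʳ (𝕖 i)))) ,
  refl

MonomialFrac-times : ∀ {n} {u v : Frac n} {a b} → MonomialFrac u a → MonomialFrac v b →
                     MonomialFrac (opFrac times u v) (a ⊕ b)
MonomialFrac-times {u = N₁ , D₁} {N₂ , D₂} {a} {b} (d₁ , N₁≡ , D₁≡) (d₂ , N₂≡ , D₂≡) =
  d₁ ⊕ d₂ ,
  trans (embed-*P N₁ N₂) (trans (cong₂ _*L_ N₁≡ N₂≡) (cong monomial (⊕-interchange a d₁ b d₂))) ,
  trans (embed-*P D₁ D₂) (cong₂ _*L_ D₁≡ D₂≡)

MonomialFrac-div : ∀ {n} {u v : Frac n} {a b} → MonomialFrac u a → MonomialFrac v b →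
                   MonomialFrac (opFrac div u v) (a ⊖ b)
MonomialFrac-div {u = N₁ , D₁} {N₂ , D₂} {a} {b} (d₁ , N₁≡ , D₁≡) (d₂ , N₂≡ , D₂≡) =
  d₁ ⊕ (b ⊕ d₂) ,
  trans (embed-*P N₁ D₂) (trans (cong₂ _*L_ N₁≡ D₂≡) (cong monomial (sym (⊖-⊕-cancel a b d₁ d₂)))) ,
  trans (embed-*P D₁ N₂) (cong₂ _*L_ D₁≡ N₂≡)

NonZeroP-MonomialFrac : ∀ {n} {N D : Poly n} {c} → MonomialFrac (N , D) c → NonZeroP N
NonZeroP-MonomialFrac {N = N} {c = c} (d , N≡ , _) = NonZeroP-embed N {c ⊕ d} λ c≡0 →
  1≢0 (trans (sym (coeffL-singleton (c ⊕ d))) (trans (cong (λ X → coeffL X (c ⊕ d)) (sym N≡)) c≡0))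
  where
  1≢0 : 1ℤ ≢ 0ℤ
  1≢0 ()
  coeffL-singleton : ∀ x → coeffL (monomial x) x ≡ 1ℤ
  coeffL-singleton x rewrite dec-true (x ≟ᵉ x) refl = refl

Reflects-reciprocal : ∀ {n} {u : Frac n} {i} → MonomialFrac u (⊝ 𝕖 i) → Reflects (varP i , oneP) u
Reflects-reciprocal {i = i} (d , N≡ , D≡) =
  d ,
  trans N≡ (cong monomial (⊕-comm (⊝ 𝕖 i) d)) ,
  trans D≡ (cong monomial (sym (trans (cong (d ⊖_) toExponent-𝟘) (⊖-𝟘 d))))

liftNode : ∀ {n k} → Node n k → Node n (suc k)
liftNode (inj₁ i) = inj₁ i
liftNode (inj₂ j) = inj₂ (suc j)

value-liftNode : ∀ {n k} (gs : Gates n k) g (u : Node n k) → value (gs ▷ g) (liftNode u) ≡ value gs u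
value-liftNode gs g (inj₁ i) = refl
value-liftNode gs g (inj₂ j) = refl

Σᵉ : ∀ {n} → List (Fin n) → Exponent n
Σᵉ = List.foldr (λ i c → 𝕖 i ⊕ c) 𝟘

record Stage (n k : ℕ) (done : List (Fin n)) : Set where
  field
    gates            : Gates n k
    wellDefined      : WellDefined gates
    product          : Node n k
    product-monomial : MonomialFrac (value gates product) (Σᵉ done)
    reciprocal       : ∀ {i} → i ∈ done → ∃[ u ] Reflects (varP i , oneP) (value gates u)

open Stage

stage-pair : ∀ {n} (v w : Fin n) → Stage n 3 (v ∷ w ∷ [])
stage-pair v w = record
  { gates            = (([] ▷ (times , inj₁ v , inj₁ w))
                         ▷ (div , inj₁ w , inj₂ zero))
                         ▷ (div , inj₁ v , inj₂ (suc zero))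
  ; wellDefined      = cons (cons (cons [] λ ()) λ _ → NonZeroP-MonomialFrac vw) λ _ → NonZeroP-MonomialFrac vw
  ; product          = inj₂ (suc (suc zero))
  ; product-monomial = subst (MonomialFrac _) (cong (𝕖 v ⊕_) (sym (⊕-identityʳ (𝕖 w)))) vw
  ; reciprocal       = λ { (here refl)         → inj₂ (suc zero) , Reflects-reciprocal w/vw
                         ; (there (here refl)) → inj₂ zero , Reflects-reciprocal v/vw }
  }
  where
  x : _ → Frac _
  x i = varP i , oneP
  vw : MonomialFrac (opFrac times (x v) (x w)) (𝕖 v ⊕ 𝕖 w)
  vw = MonomialFrac-times (MonomialFrac-var v) (MonomialFrac-var w)
  w/vw : MonomialFrac (opFrac div (x w) (opFrac times (x v) (x w))) (⊝ 𝕖 v)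
  w/vw = subst (MonomialFrac _) (⊖-⊕-cancelʳ (𝕖 w) (𝕖 v)) (MonomialFrac-div (MonomialFrac-var w) vw)
  v/vw : MonomialFrac (opFrac div (x v) (opFrac times (x v) (x w))) (⊝ 𝕖 w)
  v/vw = subst (MonomialFrac _)
               (trans (cong (𝕖 v ⊖_) (⊕-comm (𝕖 v) (𝕖 w))) (⊖-⊕-cancelʳ (𝕖 v) (𝕖 w)))
               (MonomialFrac-div (MonomialFrac-var v) vw)

stage-∷ : ∀ {n k done} → Stage n k done → (v : Fin n) → Stage n (2 + k) (v ∷ done)
stage-∷ {n} {k} {done} st v = record
  { gates            = gates′
  ; wellDefined      = cons (cons (wellDefined st) λ ()) λ _ → NonZeroP-MonomialFrac vQ
  ; product          = inj₂ (suc zero)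
  ; product-monomial = vQ
  ; reciprocal       = λ { (here refl) → inj₂ zero , Reflects-reciprocal Q/vQ
                         ; (there i∈)  → lift₂ (reciprocal st i∈) }
  }
  where
  Q = product st
  gates₁ : Gates n (suc k)
  gates₁ = gates st ▷ (times , inj₁ v , Q)
  gates′ : Gates n (2 + k)
  gates′ = gates₁ ▷ (div , liftNode Q , inj₂ zero)
  vQ : MonomialFrac (value gates₁ (inj₂ zero)) (𝕖 v ⊕ Σᵉ done)
  vQ = MonomialFrac-times (MonomialFrac-var v) (product-monomial st)
  Q/vQ : MonomialFrac (value gates′ (inj₂ zero)) (⊝ 𝕖 v)
  Q/vQ = subst₂ (λ u → MonomialFrac (opFrac div u (value gates₁ (inj₂ zero))))
                (sym (value-liftNode (gates st) _ Q)) (⊖-⊕-cancelʳ (Σᵉ done) (𝕖 v))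
                (MonomialFrac-div (product-monomial st) vQ)
  lift₂ : ∀ {i} → ∃[ u ] Reflects (varP i , oneP) (value (gates st) u) →
          ∃[ u ] Reflects (varP i , oneP) (value gates′ u)
  lift₂ (u , r) =
    liftNode (liftNode u) ,
    subst (Reflects _) (sym (trans (value-liftNode _ _ (liftNode u)) (value-liftNode _ _ u))) r

stage-++ : ∀ {n k done} → Stage n k done → (vs : List (Fin n)) → Stage n (length vs * 2 + k) (vs ++ done)
stage-++ st []       = st
stage-++ st (v ∷ vs) = stage-∷ (stage-++ st vs) v

Σᵉ-↭ : ∀ {n} {xs ys : List (Fin n)} → xs ↭ ys → Σᵉ xs ≡ Σᵉ ys
Σᵉ-↭ ↭.refl         = refl
Σᵉ-↭ (↭.prep i p)   = cong (𝕖 i ⊕_) (Σᵉ-↭ p)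
Σᵉ-↭ (↭.swap i j p) =
  trans (cong (λ c → 𝕖 i ⊕ (𝕖 j ⊕ c)) (Σᵉ-↭ p)) (x∙yz≈y∙xz (𝕖 i) (𝕖 j) _)
Σᵉ-↭ (↭.trans p q)  = trans (Σᵉ-↭ p) (Σᵉ-↭ q)

stage-↭ : ∀ {n k done done′} → done ↭ done′ → Stage n k done → Stage n k done′
stage-↭ p st = record
  { gates            = gates st
  ; wellDefined      = wellDefined st
  ; product          = product st
  ; product-monomial = subst (MonomialFrac _) (Σᵉ-↭ p) (product-monomial st)
  ; reciprocal       = λ i∈ → reciprocal st (↭.∈-resp-↭ (↭.↭-sym p) i∈)
  }

Σᵉ-map-suc : ∀ {n} (xs : List (Fin n)) → Σᵉ (List.map Fin.suc xs) ≡ 0ℤ ∷ Σᵉ xs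
Σᵉ-map-suc []       = refl
Σᵉ-map-suc (i ∷ xs) = cong (𝕖 (Fin.suc i) ⊕_) (Σᵉ-map-suc xs)

toExponent-⊥ : ∀ {n} → toExponent (monomialOf (⊥ {n})) ≡ 𝟘
toExponent-⊥ {n} = trans (cong toExponent (Vec.map-replicate _ false n)) toExponent-𝟘

Σᵉ-allFin : ∀ n → Σᵉ (List.allFin n) ≡ 𝟙
Σᵉ-allFin zero    = refl
Σᵉ-allFin (suc n) = begin
  𝕖 zero ⊕ Σᵉ (List.tabulate Fin.suc)          ≡⟨ cong (λ xs → 𝕖 zero ⊕ Σᵉ xs) (List.map-tabulate id Fin.suc) ⟨
  𝕖 zero ⊕ Σᵉ (List.map Fin.suc all)           ≡⟨ cong (𝕖 zero ⊕_) (Σᵉ-map-suc all) ⟩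
  1ℤ ∷ (toExponent (monomialOf ⊥) ⊕ Σᵉ all)    ≡⟨ cong (λ e → 1ℤ ∷ (e ⊕ Σᵉ all)) toExponent-⊥ ⟩
  1ℤ ∷ (𝟘 ⊕ Σᵉ all)                            ≡⟨ cong (1ℤ ∷_) (trans (⊕-identityˡ _) (Σᵉ-allFin n)) ⟩
  1ℤ ∷ 𝟙                                        ∎
  where
  all = List.allFin n
  open ≡-Reasoning

stage-allFin : ∀ m → Stage (2 + m) (m * 2 + 3) (List.allFin (2 + m))
stage-allFin m =
  subst (λ k → Stage (2 + m) k (List.allFin (2 + m)))
        (cong (λ l → l * 2 + 3) (List.length-tabulate {n = m} (Fin.suc ∘ Fin.suc)))
        (stage-↭ (↭.++-comm later (zero ∷ suc zero ∷ [])) (stage-++ (stage-pair zero (suc zero)) later))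
  where
  later : List (Fin (2 + m))
  later = List.tabulate (Fin.suc ∘ Fin.suc)

allSubsets-∁ : ∀ n → allSubsets n ↭ List.map ∁ (allSubsets n)
allSubsets-∁ zero    = ↭.refl
allSubsets-∁ (suc n) = begin
  List.map (true ∷_) S ++ List.map (false ∷_) S
    ↭⟨ ↭.++-comm (List.map (true ∷_) S) _ ⟩
  List.map (false ∷_) S ++ List.map (true ∷_) S
    ↭⟨ ↭.++⁺ (↭.map⁺ _ (allSubsets-∁ n)) (↭.map⁺ _ (allSubsets-∁ n)) ⟩
  List.map (false ∷_) (List.map ∁ S) ++ List.map (true ∷_) (List.map ∁ S)
    ≡⟨ cong₂ _++_ (List.map-∘ S) (List.map-∘ S) ⟨
  List.map (∁ ∘ (true ∷_)) S ++ List.map (∁ ∘ (false ∷_)) S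
    ≡⟨ cong₂ _++_ (List.map-∘ S) (List.map-∘ S) ⟩
  List.map ∁ (List.map (true ∷_) S) ++ List.map ∁ (List.map (false ∷_) S)
    ≡⟨ List.map-++ ∁ (List.map (true ∷_) S) _ ⟨
  List.map ∁ (allSubsets (suc n))
    ∎
  where
  S = allSubsets n
  open ↭.PermutationReasoning

filterᵇ-map : ∀ {A B : Set} (f : B → Bool) (g : A → B) xs →
              List.filter (λ b → T? (f b)) (List.map g xs) ≡ List.map g (List.filter (λ a → T? (f (g a))) xs)
filterᵇ-map f g []       = refl
filterᵇ-map f g (x ∷ xs) with f (g x)
... | true  = cong (g x ∷_) (filterᵇ-map f g xs)
... | false = filterᵇ-map f g xs

𝟙⊖∁ : ∀ {n} (B : Subset n) → 𝟙 ⊖ toExponent (monomialOf (∁ B)) ≡ toExponent (monomialOf B)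
𝟙⊖∁ []          = refl
𝟙⊖∁ (true ∷ B)  = cong (1ℤ ∷_) (𝟙⊖∁ B)
𝟙⊖∁ (false ∷ B) = cong (0ℤ ∷_) (𝟙⊖∁ B)

reflect-basisGenPoly : ∀ {n} (P : Subset n → Bool) →
                       reflect 𝟙 (embed (basisGenPoly P)) ↭ embed (basisGenPoly (P ∘ ∁))
reflect-basisGenPoly {n} P = begin
  reflect 𝟙 (embed (List.map term (bases P S)))    ≡⟨ cong (reflect 𝟙) (List.map-∘ (bases P S)) ⟨
  reflect 𝟙 (List.map embedTerm (bases P S))       ≡⟨ List.map-∘ (bases P S) ⟨
  List.map dualTerm (bases P S)                     ↭⟨ ↭.map⁺ dualTerm (↭.filter-↭ _ (allSubsets-∁ n)) ⟩
  List.map dualTerm (bases P (List.map ∁ S))        ≡⟨ cong (List.map dualTerm) (filterᵇ-map P ∁ S) ⟩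
  List.map dualTerm (List.map ∁ (bases (P ∘ ∁) S))  ≡⟨ List.map-∘ _ ⟨
  List.map (dualTerm ∘ ∁) (bases (P ∘ ∁) S)         ≡⟨ List.map-cong (λ B → cong (1ℤ ,_) (𝟙⊖∁ B)) _ ⟩
  List.map embedTerm (bases (P ∘ ∁) S)              ≡⟨ List.map-∘ _ ⟩
  embed (List.map term (bases (P ∘ ∁) S))           ∎
  where
  S = allSubsets n
  bases : (Subset n → Bool) → List (Subset n) → List (Subset n)
  bases Q = List.filter (λ B → T? (Q B))
  term : Subset n → ℤ × Monomial n
  term B = 1ℤ , monomialOf B
  embedTerm dualTerm : Subset n → ℤ × Exponent n
  embedTerm B = 1ℤ , toExponent (monomialOf B)
  dualTerm  B = 1ℤ , 𝟙 ⊖ toExponent (monomialOf B)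
  open ↭.PermutationReasoning

basisGenPoly-cong : ∀ {n} {P Q : Subset n → Bool} → (∀ B → P B ≡ Q B) → basisGenPoly P ≡ basisGenPoly Q
basisGenPoly-cong {P = P} {Q} P≗Q =
  cong (List.map _) (List.filter-≐ (λ B → T? (P B)) (λ B → T? (Q B))
                                   ((λ {B} → subst T (P≗Q B)) , (λ {B} → subst T (sym (P≗Q B))))
                                   (allSubsets _))

fDual-reflected : ∀ {n} (M : Matroid n) {N D A B W V : Poly n} →
                  MonomialFrac (W , V) 𝟙 → Reflects (N , D) (A , B) → N ≈P (f M *P D) →
                  (W *P A) ≈P (fDual M *P (V *P B))
fDual-reflected M {N} {D} {A} {B} {W} {V} (d , W≡ , V≡) (e , A≡ , B≡) N≈fD =
  ≈L-embed {p = W *P A} {fDual M *P (V *P B)} (begin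
    embed (W *P A)
      ≡⟨ embed-*P W A ⟩
    embed W *L embed A
      ≡⟨ cong₂ _*L_ W≡ A≡ ⟩
    monomial (𝟙 ⊕ d) *L reflect e (embed N)
      ≡⟨ monomial-*L-reflect (𝟙 ⊕ d) e (embed N) ⟩
    reflect (𝟙 ⊕ d ⊕ e) (embed N)
      ≈⟨ reflect-≈L (𝟙 ⊕ d ⊕ e) {embed N} {embed (f M *P D)} (embed-≈ {p = N} {f M *P D} N≈fD) ⟩
    reflect (𝟙 ⊕ d ⊕ e) (embed (f M *P D))
      ≡⟨ cong₂ reflect (⊕-assoc 𝟙 d e) (embed-*P (f M) D) ⟩
    reflect (𝟙 ⊕ (d ⊕ e)) (embed (f M) *L embed D)
      ≡⟨ reflect-*L 𝟙 (d ⊕ e) (embed (f M)) (embed D) ⟩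
    reflect 𝟙 (embed (f M)) *L reflect (d ⊕ e) (embed D)
      ≈⟨ coeffL-↭ (*L-↭ˡ _ (reflect-basisGenPoly (isBasis M))) ⟩
    embed (fDual M) *L reflect (d ⊕ e) (embed D)
      ≡⟨ cong (embed (fDual M) *L_) (monomial-*L-reflect d e (embed D)) ⟨
    embed (fDual M) *L (monomial d *L reflect e (embed D))
      ≡⟨ cong₂ (λ X Y → embed (fDual M) *L (X *L Y)) V≡ B≡ ⟨
    embed (fDual M) *L (embed V *L embed B)
      ≡⟨ cong (embed (fDual M) *L_) (embed-*P V B) ⟨
    embed (fDual M) *L embed (V *P B)
      ≡⟨ embed-*P (fDual M) (V *P B) ⟨
    embed (fDual M *P (V *P B))
      ∎)
  where open import Relation.Binary.Reasoning.Setoid (≈L-setoid _)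

Representable : ∀ {n} → ℕ → Poly n → Set
Representable {n} s p = ∃[ C ] Represents {n} {s} C p

dualCircuit : ∀ {n k s} → Stage n k (List.allFin n) →
              (M : Matroid n) (C : Circuit n s) → Represents C (f M) → Representable (suc (s + k)) (fDual M)
dualCircuit {n} {k} {s} st M (circuit gs out) (wd , N≈fD) =
  circuit (graft gs ▷ (times , liftPre s (product st) , rename out)) (inj₂ zero) ,
  cons (WellDefined-graft ρ-reflects (wellDefined st) wd) (λ ()) ,
  fDual-reflected M product-𝟙 (Reflects-graft ρ-reflects gs out) N≈fD
  where
  ρ : Fin n → Node n k
  ρ i = proj₁ (reciprocal st (∈-allFin i))
  ρ-reflects : ∀ i → Reflects (varP i , oneP) (value (gates st) (ρ i))
  ρ-reflects i = proj₂ (reciprocal st (∈-allFin i))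
  open Graft (gates st) ρ
  product-𝟙 : MonomialFrac (value (graft gs) (liftPre s (product st))) 𝟙
  product-𝟙 = subst₂ MonomialFrac (sym (value-liftPre gs (product st))) (Σᵉ-allFin n) (product-monomial st)

padding : ∀ {n} → Fin n → (k : ℕ) → Gates n k
padding i zero    = []
padding i (suc k) = padding i k ▷ (times , inj₁ i , inj₁ i)

WellDefined-padding : ∀ {n} (i : Fin n) k → WellDefined (padding i k)
WellDefined-padding i zero    = []
WellDefined-padding i (suc k) = cons (WellDefined-padding i k) λ ()

variable-circuit : ∀ k → Representable {1} k (varP zero)
variable-circuit k = circuit (padding zero k) (inj₁ zero) , WellDefined-padding zero k , λ _ → refl

one-circuit : ∀ k → Representable {1} (suc k) oneP
one-circuit k =
  circuit (padding zero k ▷ (div , inj₁ zero , inj₁ zero)) (inj₂ zero) ,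
  cons (WellDefined-padding zero k) (λ _ → (1 ∷ []) , λ ()) ,
  λ _ → refl

basisGenPoly₁ : (P : Subset 1 → Bool) → ∀ {b₁ b₀} → P (true ∷ []) ≡ b₁ → P (false ∷ []) ≡ b₀ →
                basisGenPoly P ≡ (if b₁ then varP zero else []) ++ (if b₀ then oneP else [])
basisGenPoly₁ P {true}  {true}  eq₁ eq₀ rewrite eq₁ | eq₀ = refl
basisGenPoly₁ P {true}  {false} eq₁ eq₀ rewrite eq₁ | eq₀ = refl
basisGenPoly₁ P {false} {true}  eq₁ eq₀ rewrite eq₁ | eq₀ = refl
basisGenPoly₁ P {false} {false} eq₁ eq₀ rewrite eq₁ | eq₀ = refl

fDual₁ : (M : Matroid 1) → fDual M ≡ varP zero ⊎ fDual M ≡ oneP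
fDual₁ M = by-cases (isBasis M (true ∷ [])) (isBasis M (false ∷ [])) refl refl
  where
  by-cases : ∀ b₁ b₀ → isBasis M (true ∷ []) ≡ b₁ → isBasis M (false ∷ []) ≡ b₀ →
             fDual M ≡ varP zero ⊎ fDual M ≡ oneP
  by-cases true  true  eq₁ eq₀ =
    contradiction (exchange M (true ∷ []) (false ∷ []) (subst T (sym eq₁) _) (subst T (sym eq₀) _)
                            zero Vec.here λ ())
                  λ { (zero , () , _) }
  by-cases false false eq₁ eq₀ =
    contradiction (basis-nonempty M) λ { ((true ∷ []) , t) → subst T eq₁ t ; ((false ∷ []) , t) → subst T eq₀ t }
  by-cases true  false eq₁ eq₀ = inj₂ (basisGenPoly₁ (dualBases M) eq₀ eq₁)
  by-cases false true  eq₁ eq₀ = inj₁ (basisGenPoly₁ (dualBases M) eq₀ eq₁)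

circuit-size : ∀ m s → suc (s + (m * 2 + 3)) ≡ s + 2 * (2 + m)
circuit-size = solve-∀

lemma3 : ∀ {n s : ℕ} (M : Matroid n) (C : Circuit n s) → Represents C (f M) →
         ∃[ C' ] Represents {n} {s + 2 * n} C' (fDual M)
lemma3 {zero}        {s} M C C-represents-f =
  subst₂ Representable (sym (ℕ.+-identityʳ s))
         (basisGenPoly-cong {P = isBasis M} {dualBases M} λ { [] → refl })
         (C , C-represents-f)
lemma3 {suc zero}    {s} M _ _ with fDual₁ M
... | inj₁ dual≡x = subst (Representable (s + 2)) (sym dual≡x) (variable-circuit (s + 2))
... | inj₂ dual≡1 = subst₂ Representable (sym (ℕ.+-suc s 1)) (sym dual≡1) (one-circuit (s + 1))
lemma3 {suc (suc m)} {s} M C C-represents-f =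
  subst (λ k → Representable k (fDual M)) (circuit-size m s) (dualCircuit (stage-allFin m) M C C-represents-f)
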